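{- If $n$ is a non-negative integer and $p$ is a positive integer, then \begin{align*} \sum_{k = 1}^n \sum_{j = 0}^{k - 1} \frac{1}{(k - j)(n - j + p)} &= \frac{1}{2}\left( H_n^2 - H_n^{(2)} \right) - \frac{1}{2}\left( H_{p - 1}^2 + H_{p - 1}^{(2)} \right) \\ &\quad + H_{p - 1} \left( H_{p + n - 1} - H_n \right) + H_n \left( H_{p + n} - H_n \right) - \sum_{k = 1}^{p - 1} \frac{H_{k - 1}}{n + k}. \end{align*} In particular, \[ \sum_{k = 1}^n \sum_{j = 0}^{k - 1} \frac{1}{(k - j)(n + 1 - j)} = \frac{1}{2}\left( H_n^2 - H_n^{(2)} \right) + \frac{H_n}{n + 1}. \]
   Context: $H_n=\sum_{m=1}^n\frac1m$ and $H_n^{(2)}=\sum_{m=1}^n\frac1{m^2}$ (with $H_0=H_0^{(2)}=0$). Empty sums are $0$. -}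

module Defs where

open import Data.Nat using (ℕ; zero; suc; _∸_)
open import Data.Integer using (+_)
open import Data.Rational using (ℚ; 0ℚ; _+_; _/_)

-- inv m = 1/m for m ≥ 1 (the value at m = 0 is never used in the statement;
-- it is set to 0 only to make the function total).
inv : ℕ → ℚ
inv zero    = 0ℚ
inv (suc m) = (+ 1) / suc m

-- Σ[ i ∈ a..b ] : sumFrom a b f = f a + ... + f b  (empty, i.e. 0, if b < a)
-- implemented as: sum over i = a, a+1, ..., a + (count - 1), count = (b + 1) ∸ a
sumCount : ℕ → ℕ → (ℕ → ℚ) → ℚ
sumCount a zero    f = 0ℚ
sumCount a (suc c) f = f a + sumCount (suc a) c f

sumFromTo : ℕ → ℕ → (ℕ → ℚ) → ℚ
sumFromTo a b f = sumCount a (suc b ∸ a) f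

H : ℕ → ℚ
H n = sumFromTo 1 n inv

H2 : ℕ → ℚ
H2 n = sumFromTo 1 n (λ m → inv m Data.Rational.* inv m)

{-# OPTIONS --safe #-}
-- Putting c = n - j, the inner sums over k become harmonic numbers, so both double sums
-- equal Σ_{c=1}^n H_c / (p + c).  For p = 1 the summand H_c / (c + 1) is the increment of
-- ½ (H_c² - H_c^{(2)}) from c to c + 1, so that sum telescopes.  Passing from p to p + 1
-- changes the sum by an explicit amount, found by induction on n with the partial fraction
-- 1/((n+1)(n+p+1)) = (1/p) (1/(n+1) - 1/(n+p+1)); the closed form then follows by
-- induction on p.
module Submission where

open import Defs
open import Data.Nat using (ℕ; zero; suc; _∸_; _≥_)
open import Data.Rational using (ℚ; _+_; _-_; _*_; ½)
open import Data.Product using (_×_)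
open import Relation.Binary.PropositionalEquality using (_≡_)

import Data.Nat as ℕ
import Data.Nat.Properties as ℕ
open import Data.Nat.Coprimality as Coprimality using (1-coprimeTo)
import Data.Integer as ℤ
import Data.Integer.Properties as ℤ
open import Data.List using (_∷_; [])
open import Data.Product using (_,_)
open import Data.Rational using (mkℚ+; 0ℚ; 1ℚ; 1/_)
open import Data.Rational.Properties
  using (+-*-commutativeRing; _≟_; normalize-coprime; /-cong; *-inverseˡ;
         +-identityˡ; +-assoc; +-comm; *-distribʳ-+; *-zeroˡ)
open import Level using (0ℓ)
open import Relation.Binary.PropositionalEquality
  using (refl; sym; trans; cong; cong₂; module ≡-Reasoning)
open import Relation.Nullary.Decidable.Core using (dec⇒maybe)
open import Tactic.RingSolver using (solve-∀; solve)
open import Tactic.RingSolver.Core.AlmostCommutativeRing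
  using (AlmostCommutativeRing; fromCommutativeRing)

open ≡-Reasoning

ℚ-ring : AlmostCommutativeRing 0ℓ 0ℓ
ℚ-ring = fromCommutativeRing +-*-commutativeRing (λ x → dec⇒maybe (0ℚ ≟ x))

sumCount-cong : ∀ a c {f g : ℕ → ℚ} → (∀ i → f i ≡ g i) → sumCount a c f ≡ sumCount a c g
sumCount-cong a zero    f≡g = refl
sumCount-cong a (suc c) f≡g = cong₂ _+_ (f≡g a) (sumCount-cong (suc a) c f≡g)

sumCount-shift : ∀ a c (f : ℕ → ℚ) → sumCount (suc a) c f ≡ sumCount a c (λ i → f (suc i))
sumCount-shift a zero    f = refl
sumCount-shift a (suc c) f = cong (f (suc a) +_) (sumCount-shift (suc a) c f)

sumCount-snoc : ∀ a c (f : ℕ → ℚ) → sumCount a (suc c) f ≡ sumCount a c f + f (a ℕ.+ c)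
sumCount-snoc a zero    f =
  trans (+-comm (f a) 0ℚ) (cong (λ i → 0ℚ + f i) (sym (ℕ.+-identityʳ a)))
sumCount-snoc a (suc c) f = begin
  f a + sumCount (suc a) (suc c) f
    ≡⟨ cong (f a +_) (sumCount-snoc (suc a) c f) ⟩
  f a + (sumCount (suc a) c f + f (suc a ℕ.+ c))
    ≡⟨ +-assoc (f a) _ _ ⟨
  f a + sumCount (suc a) c f + f (suc a ℕ.+ c)
    ≡⟨ cong (λ i → f a + sumCount (suc a) c f + f i) (ℕ.+-suc a c) ⟨
  f a + sumCount (suc a) c f + f (a ℕ.+ suc c) ∎

sumCount-+ : ∀ a c (f g : ℕ → ℚ) →
             sumCount a c (λ i → f i + g i) ≡ sumCount a c f + sumCount a c g
sumCount-+ a zero    f g = refl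
sumCount-+ a (suc c) f g = begin
  f a + g a + sumCount (suc a) c (λ i → f i + g i)
    ≡⟨ cong (f a + g a +_) (sumCount-+ (suc a) c f g) ⟩
  f a + g a + (sumCount (suc a) c f + sumCount (suc a) c g)
    ≡⟨ interchange (f a) (g a) _ _ ⟩
  f a + sumCount (suc a) c f + (g a + sumCount (suc a) c g) ∎
  where
  interchange : ∀ w x y z → w + x + (y + z) ≡ w + y + (x + z)
  interchange = solve-∀ ℚ-ring

sumCount-*ʳ : ∀ a c (f : ℕ → ℚ) x → sumCount a c (λ i → f i * x) ≡ sumCount a c f * x
sumCount-*ʳ a zero    f x = sym (*-zeroˡ x)
sumCount-*ʳ a (suc c) f x =
  trans (cong (f a * x +_) (sumCount-*ʳ (suc a) c f x)) (sym (*-distribʳ-+ x (f a) _))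

sumFromTo-suc : ∀ (f : ℕ → ℚ) n → sumFromTo 1 (suc n) f ≡ sumFromTo 1 n f + f (suc n)
sumFromTo-suc f n = sumCount-snoc 1 n f

H-suc : ∀ n → H (suc n) ≡ H n + inv (suc n)
H-suc = sumFromTo-suc inv

H2-suc : ∀ n → H2 (suc n) ≡ H2 n + inv (suc n) * inv (suc n)
H2-suc = sumFromTo-suc (λ m → inv m * inv m)

Σ-triangle : ∀ (f : ℕ → ℚ) (h : ℕ → ℕ → ℚ) → (∀ m j → h (suc m) (suc j) ≡ h m j) → ∀ n →
             sumFromTo 1 n (λ k → sumFromTo 0 (k ∸ 1) (λ j → f (k ∸ j) * h n j))
               ≡ sumFromTo 1 n (λ c → sumFromTo 1 c f * h c 0)
Σ-triangle f h h-shift zero    = refl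
Σ-triangle f h h-shift (suc n) = begin
  sumCount 1 (suc n) (row (suc n))
    ≡⟨ sumCount-shift 0 (suc n) (row (suc n)) ⟩
  sumCount 0 (suc n) (λ k → row (suc n) (suc k))
    ≡⟨ sumCount-cong 0 (suc n) split-row ⟩
  sumCount 0 (suc n) (λ k → f (suc k) * h (suc n) 0 + row₀ k)
    ≡⟨ sumCount-+ 0 (suc n) (λ k → f (suc k) * h (suc n) 0) row₀ ⟩
  sumCount 0 (suc n) (λ k → f (suc k) * h (suc n) 0) + sumCount 0 (suc n) row₀
    ≡⟨ cong₂ _+_ first-column remaining-rows ⟩
  sumFromTo 1 (suc n) f * h (suc n) 0 + sumFromTo 1 n (row n)
    ≡⟨ +-comm (sumFromTo 1 (suc n) f * h (suc n) 0) _ ⟩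
  sumFromTo 1 n (row n) + sumFromTo 1 (suc n) f * h (suc n) 0
    ≡⟨ cong (_+ sumFromTo 1 (suc n) f * h (suc n) 0) (Σ-triangle f h h-shift n) ⟩
  sumFromTo 1 n (λ c → sumFromTo 1 c f * h c 0) + sumFromTo 1 (suc n) f * h (suc n) 0
    ≡⟨ sumFromTo-suc (λ c → sumFromTo 1 c f * h c 0) n ⟨
  sumFromTo 1 (suc n) (λ c → sumFromTo 1 c f * h c 0) ∎
  where
  row : ℕ → ℕ → ℚ
  row m k = sumFromTo 0 (k ∸ 1) (λ j → f (k ∸ j) * h m j)

  -- agrees with row n on positive k, and is 0 rather than f 0 * h n 0 at k = 0
  row₀ : ℕ → ℚ
  row₀ k = sumCount 0 k (λ j → f (k ∸ j) * h n j)

  split-row : ∀ k → row (suc n) (suc k) ≡ f (suc k) * h (suc n) 0 + row₀ k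
  split-row k = cong (f (suc k) * h (suc n) 0 +_) (begin
    sumCount 1 k (λ j → f (suc k ∸ j) * h (suc n) j)
      ≡⟨ sumCount-shift 0 k _ ⟩
    sumCount 0 k (λ j → f (k ∸ j) * h (suc n) (suc j))
      ≡⟨ sumCount-cong 0 k (λ j → cong (f (k ∸ j) *_) (h-shift n j)) ⟩
    row₀ k ∎)

  first-column : sumCount 0 (suc n) (λ k → f (suc k) * h (suc n) 0)
                   ≡ sumFromTo 1 (suc n) f * h (suc n) 0
  first-column = trans (sumCount-*ʳ 0 (suc n) (λ k → f (suc k)) (h (suc n) 0))
                       (sym (cong (_* h (suc n) 0) (sumCount-shift 0 (suc n) f)))

  remaining-rows : sumCount 0 (suc n) row₀ ≡ sumFromTo 1 n (row n)
  remaining-rows = begin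
    0ℚ + sumCount 1 n row₀                     ≡⟨ +-identityˡ _ ⟩
    sumCount 1 n row₀                          ≡⟨ sumCount-shift 0 n row₀ ⟩
    sumCount 0 n (λ k → row n (suc k))         ≡⟨ sumCount-shift 0 n (row n) ⟨
    sumCount 1 n (row n)                       ∎

fromℕ : ℕ → ℚ
fromℕ m = mkℚ+ m 1 (Coprimality.sym (1-coprimeTo m))

fromℕ-+ : ∀ a b → fromℕ (a ℕ.+ b) ≡ fromℕ a + fromℕ b
fromℕ-+ a b =
  sym (trans (/-cong numerator refl) (normalize-coprime (Coprimality.sym (1-coprimeTo (a ℕ.+ b)))))
  where
  numerator : ℤ.+ a ℤ.* ℤ.+ 1 ℤ.+ ℤ.+ b ℤ.* ℤ.+ 1 ≡ ℤ.+ (a ℕ.+ b)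
  numerator = cong₂ ℤ._+_ (ℤ.*-identityʳ (ℤ.+ a)) (ℤ.*-identityʳ (ℤ.+ b))

inv-*-fromℕ : ∀ m → inv (suc m) * fromℕ (suc m) ≡ 1ℚ
inv-*-fromℕ m = trans (cong (_* fromℕ (suc m)) inv≡1/) (*-inverseˡ (fromℕ (suc m)))
  where
  inv≡1/ : inv (suc m) ≡ 1/ fromℕ (suc m)
  inv≡1/ = normalize-coprime (1-coprimeTo (suc m))

partial-fraction : ∀ {x y z A D : ℚ} → x * A ≡ 1ℚ → z * D ≡ 1ℚ → y * (D + A) ≡ 1ℚ →
                   z * (x - y) ≡ x * y
partial-fraction {x} {y} {z} {A} {D} xA≡1 zD≡1 y[D+A]≡1 = begin
  z * (x - y)                           ≡⟨ solve (x ∷ y ∷ z ∷ []) ℚ-ring ⟩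
  z * (x * 1ℚ - y * 1ℚ)                 ≡⟨ cong₂ (λ s t → z * (x * s - y * t)) y[D+A]≡1 xA≡1 ⟨
  z * (x * (y * (D + A)) - y * (x * A)) ≡⟨ solve (x ∷ y ∷ z ∷ A ∷ D ∷ []) ℚ-ring ⟩
  x * y * (z * D)                       ≡⟨ cong (x * y *_) zD≡1 ⟩
  x * y * 1ℚ                            ≡⟨ solve (x ∷ y ∷ []) ℚ-ring ⟩
  x * y                                 ∎

inv-partial-fraction : ∀ d m → inv (suc d) * (inv (suc m) - inv (suc d ℕ.+ suc m))
                                 ≡ inv (suc m) * inv (suc d ℕ.+ suc m)
inv-partial-fraction d m =
  partial-fraction {inv (suc m)} {inv (suc d ℕ.+ suc m)} {inv (suc d)}
    (inv-*-fromℕ m) (inv-*-fromℕ d)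
    (trans (cong (inv (suc d ℕ.+ suc m) *_) (sym (fromℕ-+ (suc d) (suc m))))
           (inv-*-fromℕ (d ℕ.+ suc m)))

H-+-suc : ∀ a b → H (a ℕ.+ suc b) ≡ H (a ℕ.+ b) + inv (a ℕ.+ suc b)
H-+-suc a b rewrite ℕ.+-suc a b = H-suc (a ℕ.+ b)

-- ½ (H n² - H⁽²⁾ n) is the elementary symmetric sum Σ_{i<j≤n} 1/(ij).
e₂-suc : ∀ n → ½ * (H (suc n) * H (suc n) - H2 (suc n))
                 ≡ ½ * (H n * H n - H2 n) + H n * inv (suc n)
e₂-suc n = begin
  ½ * (H (suc n) * H (suc n) - H2 (suc n))
    ≡⟨ cong₂ (λ h h2 → ½ * (h * h - h2)) (H-suc n) (H2-suc n) ⟩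
  ½ * ((H n + inv (suc n)) * (H n + inv (suc n)) - (H2 n + inv (suc n) * inv (suc n)))
    ≡⟨ expand (H n) (H2 n) (inv (suc n)) ⟩
  ½ * (H n * H n - H2 n) + H n * inv (suc n) ∎
  where
  expand : ∀ h h2 x → ½ * ((h + x) * (h + x) - (h2 + x * x)) ≡ ½ * (h * h - h2) + h * x
  expand = solve-∀ ℚ-ring

Hsum : ℕ → ℕ → ℚ
Hsum p n = sumFromTo 1 n (λ c → H c * inv (p ℕ.+ c))

Hsum-1 : ∀ n → Hsum 1 n ≡ ½ * (H n * H n - H2 n) + H n * inv (suc n)
Hsum-1 zero    = refl
Hsum-1 (suc n) = begin
  Hsum 1 (suc n)
    ≡⟨ sumFromTo-suc (λ c → H c * inv (suc c)) n ⟩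
  Hsum 1 n + H (suc n) * inv (suc (suc n))
    ≡⟨ cong (_+ H (suc n) * inv (suc (suc n))) (Hsum-1 n) ⟩
  ½ * (H n * H n - H2 n) + H n * inv (suc n) + H (suc n) * inv (suc (suc n))
    ≡⟨ cong (_+ H (suc n) * inv (suc (suc n))) (e₂-suc n) ⟨
  ½ * (H (suc n) * H (suc n) - H2 (suc n)) + H (suc n) * inv (suc (suc n)) ∎

Hsum-recurrence : ∀ q n → Hsum (suc (suc q)) n
                            ≡ Hsum (suc q) n + (inv (suc q) * (H (suc q ℕ.+ n) - H n - H (suc q))
                                                + H n * inv (suc (suc q) ℕ.+ n))
Hsum-recurrence q zero rewrite ℕ.+-identityʳ q =
  vanish (inv (suc q)) (H (suc q)) (inv (suc (suc q)))
  where
  vanish : ∀ z x w → 0ℚ ≡ 0ℚ + (z * (x - 0ℚ - x) + 0ℚ * w)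
  vanish = solve-∀ ℚ-ring
Hsum-recurrence q (suc n) = begin
  Hsum (suc (suc q)) (suc n)
    ≡⟨ sumFromTo-suc (λ c → H c * inv (suc (suc q) ℕ.+ c)) n ⟩
  Hsum (suc (suc q)) n + H (suc n) * e
    ≡⟨ cong (_+ H (suc n) * e) (Hsum-recurrence q n) ⟩
  Hsum (suc q) n + (inv (suc q) * (H (suc q ℕ.+ n) - H n - H (suc q))
                    + H n * inv (suc (suc q) ℕ.+ n)) + H (suc n) * e
    ≡⟨ telescope (Hsum (suc q) n) (H (suc q ℕ.+ n)) (H n) (H (suc q)) (inv (suc q)) e
         (sumFromTo-suc (λ c → H c * inv (suc q ℕ.+ c)) n) (H-suc n) (H-+-suc (suc q) n)
         (cong inv (ℕ.+-suc (suc q) n)) (inv-partial-fraction q n) ⟩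
  Hsum (suc q) (suc n) + (inv (suc q) * (H (suc q ℕ.+ suc n) - H (suc n) - H (suc q))
                          + H (suc n) * e) ∎
  where
  e : ℚ
  e = inv (suc (suc q) ℕ.+ suc n)

  -- the partial fraction z (a - b) = a b absorbs the terms created by the step n ↦ suc n
  telescope : ∀ t y h Q z e {t′ y′ h′ a b w} →
              t′ ≡ t + h′ * b → h′ ≡ h + a → y′ ≡ y + b → b ≡ w → z * (a - b) ≡ a * b →
              t + (z * (y - h - Q) + h * w) + h′ * e ≡ t′ + (z * (y′ - h′ - Q) + h′ * e)
  telescope t y h Q z e {a = a} {b} refl refl refl refl za-zb≡ab = begin
    t + (z * (y - h - Q) + h * b) + (h + a) * e
      ≡⟨ solve (t ∷ y ∷ h ∷ a ∷ b ∷ Q ∷ z ∷ e ∷ []) ℚ-ring ⟩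
    t + h * b + z * (a - b) + (z * (y + b - (h + a) - Q) + (h + a) * e)
      ≡⟨ cong (λ s → t + h * b + s + (z * (y + b - (h + a) - Q) + (h + a) * e)) za-zb≡ab ⟩
    t + h * b + a * b + (z * (y + b - (h + a) - Q) + (h + a) * e)
      ≡⟨ solve (t ∷ y ∷ h ∷ a ∷ b ∷ Q ∷ z ∷ e ∷ []) ℚ-ring ⟩
    t + (h + a) * b + (z * (y + b - (h + a) - Q) + (h + a) * e) ∎

closedForm : ℕ → ℕ → ℚ
closedForm q n = ½ * (H n * H n - H2 n)
                 - ½ * (H q * H q + H2 q)
                 + H q * (H (q ℕ.+ n) - H n)
                 + H n * (H (suc q ℕ.+ n) - H n)
                 - sumFromTo 1 q (λ k → H (k ∸ 1) * inv (n ℕ.+ k))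

Hsum≡closedForm : ∀ q n → Hsum (suc q) n ≡ closedForm q n
Hsum≡closedForm zero    n = trans (Hsum-1 n) (base (H n) (H2 n) (H-suc n))
  where
  base : ∀ h h2 {a y} → y ≡ h + a →
         ½ * (h * h - h2) + h * a
           ≡ ½ * (h * h - h2) - ½ * (0ℚ * 0ℚ + 0ℚ) + 0ℚ * (h - h) + h * (y - h) - 0ℚ
  base h h2 {a} refl = solve (h ∷ h2 ∷ a ∷ []) ℚ-ring
Hsum≡closedForm (suc q) n = begin
  Hsum (suc (suc q)) n
    ≡⟨ Hsum-recurrence q n ⟩
  Hsum (suc q) n + correction
    ≡⟨ cong (_+ correction) (Hsum≡closedForm q n) ⟩
  closedForm q n + correction
    ≡⟨ step (H n) (H2 n) (H q) (H2 q) (H (q ℕ.+ n)) Σq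
            (H-suc q) (H2-suc q) (H-suc (q ℕ.+ n)) (H-suc (suc q ℕ.+ n)) last-term ⟩
  closedForm (suc q) n ∎
  where
  correction : ℚ
  correction = inv (suc q) * (H (suc q ℕ.+ n) - H n - H (suc q)) + H n * inv (suc (suc q) ℕ.+ n)

  Σq : ℚ
  Σq = sumFromTo 1 q (λ k → H (k ∸ 1) * inv (n ℕ.+ k))

  last-term : sumFromTo 1 (suc q) (λ k → H (k ∸ 1) * inv (n ℕ.+ k))
                ≡ Σq + H q * inv (suc q ℕ.+ n)
  last-term = trans (sumFromTo-suc (λ k → H (k ∸ 1) * inv (n ℕ.+ k)) q)
                    (cong (λ m → Σq + H q * inv m) (ℕ.+-comm n (suc q)))

  step : ∀ h h2 hq hq2 y s {hq′ hq2′ y′ y″ s′ z u v} →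
         hq′ ≡ hq + z → hq2′ ≡ hq2 + z * z → y′ ≡ y + u → y″ ≡ y′ + v → s′ ≡ s + hq * u →
         ½ * (h * h - h2) - ½ * (hq * hq + hq2) + hq * (y - h) + h * (y′ - h) - s
             + (z * (y′ - h - hq′) + h * v)
           ≡ ½ * (h * h - h2) - ½ * (hq′ * hq′ + hq2′) + hq′ * (y′ - h) + h * (y″ - h) - s′
  step h h2 hq hq2 y s {z = z} {u} {v} refl refl refl refl refl =
    solve (h ∷ h2 ∷ hq ∷ hq2 ∷ y ∷ s ∷ z ∷ u ∷ v ∷ []) ℚ-ring

proposition11 : ((n p : ℕ) → p ≥ 1 →
      sumFromTo 1 n (λ k → sumFromTo 0 (k ∸ 1) (λ j → inv (k ∸ j) * inv ((n ∸ j) Data.Nat.+ p)))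
        ≡ ½ * (H n * H n - H2 n)
          - ½ * (H (p ∸ 1) * H (p ∸ 1) + H2 (p ∸ 1))
          + H (p ∸ 1) * (H ((p Data.Nat.+ n) ∸ 1) - H n)
          + H n * (H (p Data.Nat.+ n) - H n)
          - sumFromTo 1 (p ∸ 1) (λ k → H (k ∸ 1) * inv (n Data.Nat.+ k)))
    ×
    ((n : ℕ) →
      sumFromTo 1 n (λ k → sumFromTo 0 (k ∸ 1) (λ j → inv (k ∸ j) * inv ((suc n) ∸ j)))
        ≡ ½ * (H n * H n - H2 n) + H n * inv (suc n))
proposition11 =
    (λ { n zero    ()
       ; n (suc q) _ → begin
           _ ≡⟨ Σ-triangle inv (λ m j → inv ((m ∸ j) ℕ.+ suc q)) (λ _ _ → refl) n ⟩
           sumFromTo 1 n (λ c → H c * inv (c ℕ.+ suc q))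
             ≡⟨ sumCount-cong 1 n (λ c → cong (λ m → H c * inv m) (ℕ.+-comm c (suc q))) ⟩
           Hsum (suc q) n ≡⟨ Hsum≡closedForm q n ⟩
           closedForm q n ∎ })
  , λ n → trans (Σ-triangle inv (λ m j → inv (suc m ∸ j)) (λ _ _ → refl) n) (Hsum-1 n)
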